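{- There is an infinite set $S$ of integers such that for every $m \in S$, $n_m \le 0.4643\,(m-2)^{m-2}$.
   Context: For a graph $G$, a $k$-list assignment $L$ assigns to each vertex $v$ a set $L(v)$ of exactly $k$ colors; a proper $L$-coloring chooses $c(v)\in L(v)$ for each $v$ with adjacent vertices receiving different colors. The choice number $ch(G)$ is the least $k$ such that for every $k$-list assignment $L$ of $G$ there is a proper $L$-coloring. $K_{m,n}$ denotes the complete bipartite graph with parts of sizes $m$ and $n$. For an integer $m\ge 3$, $n_m$ denotes the smallest positive integer $n$ such that $ch(K_{m,n}) = m-1$. -}

module Defs where

open import Data.Nat using (ℕ; _<_; _≤_; _∸_)
open import Data.Fin using (Fin)
open import Data.Sum using (_⊎_; inj₁; inj₂)
open import Data.Unit using (⊤)
open import Data.Empty using (⊥)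
open import Data.Product using (Σ; _×_)
open import Data.List using (List; length)
open import Data.List.Membership.Propositional using (_∈_)
open import Data.List.Relation.Unary.Unique.Propositional using (Unique)
open import Relation.Binary.PropositionalEquality using (_≡_; _≢_)
open import Relation.Nullary using (¬_)

record ListAssignment (V : Set) (k : ℕ) : Set where
  field
    L        : V → List ℕ
    distinct : ∀ v → Unique (L v)
    size     : ∀ v → length (L v) ≡ k
open ListAssignment public

ProperLColoring : (V : Set) (Adj : V → V → Set) {k : ℕ} → ListAssignment V k → (V → ℕ) → Set
ProperLColoring V Adj A c =
  (∀ v → c v ∈ L A v) × (∀ u v → Adj u v → c u ≢ c v)

Choosable : (V : Set) (Adj : V → V → Set) → ℕ → Set
Choosable V Adj k = (A : ListAssignment V k) → Σ (V → ℕ) (ProperLColoring V Adj A)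

ChoiceNumberIs : (V : Set) (Adj : V → V → Set) → ℕ → Set
ChoiceNumberIs V Adj k = Choosable V Adj k × (∀ j → j < k → ¬ Choosable V Adj j)

KV : ℕ → ℕ → Set
KV m n = Fin m ⊎ Fin n

KAdj : (m n : ℕ) → KV m n → KV m n → Set
KAdj m n (inj₁ _) (inj₁ _) = ⊥
KAdj m n (inj₁ _) (inj₂ _) = ⊤
KAdj m n (inj₂ _) (inj₁ _) = ⊤
KAdj m n (inj₂ _) (inj₂ _) = ⊥

IsNm : ℕ → ℕ → Set
IsNm m n = (1 ≤ n) × ChoiceNumberIs (KV m n) (KAdj m n) (m ∸ 1)
         × (∀ n' → 1 ≤ n' → n' < n → ¬ ChoiceNumberIs (KV m n') (KAdj m n') (m ∸ 1))

{-# OPTIONS --safe #-}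
-- For m = k + 2 with k = 5t and t = s + 2, take colors (w, i) with w, i < k,
-- grouped into k blocks B w = P w ∪ Q w, where P w holds the first t colors of
-- the block and Q w the other 4t.  The left side of K_{m,n} receives the k
-- blocks and two hub lists P 0 ∪ … ∪ P 4 and P 5 ∪ … ∪ P 9; the right side
-- receives every transversal of the blocks (one color from each block) that,
-- on each of the groups 0‥4 and 5‥9, does not lie entirely in the Q w.  A
-- coloring of the left side takes one color from each block and a P-color in
-- each group, so it uses up one of the right lists completely and cannot be
-- extended.  There are (k⁵ - (4t)⁵)² k^{5s} = 2101² t¹⁰ k^{5s} = (2101²/5¹⁰) k^k
-- such lists, and 2101²/5¹⁰ < 0.4643.  Since adding a right vertex raises the
-- choice number by at most one, the least n for which K_{m,n} is not
-- k-choosable is n_m, and it can be found by exhaustive search: choosability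
-- of a finite graph only depends on list assignments with at most
-- (number of vertices) · k colors.
module Submission where

open import Defs
open import Data.Nat using (ℕ; zero; suc; _+_; _*_; _∸_; _^_; _≤_; _<_; z≤n; s≤s; s≤s⁻¹; _≟_; NonZero)
open import Data.Nat.Properties
  using (≤-refl; ≤-reflexive; ≤-trans; <⇒≢; ≤ᵇ⇒≤; m≤n⇒m⊓n≡m; n≤1+n; m≤m+n; m≤n+m; +-assoc; +-cancelʳ-≡;
         *-distribˡ-+; *-distribʳ-+; *-monoˡ-≤; *-monoʳ-≤; ^-distribˡ-+-*; [m*n]*[o*p]≡[m*o]*[n*p]; module ≤-Reasoning)
open import Data.Nat.Tactic.RingSolver using (solve-∀)
open import Data.Nat.DivMod using (_/_; +-distrib-/-∣ʳ; m<n⇒m/n≡0; m*n/n≡m)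
open import Data.Nat.Divisibility using (n∣m*n)
open import Data.Fin as Fin using (Fin; zero; suc; toℕ)
open import Data.Fin.Properties
  using (any?; ¬∀⟶∃¬-smallest; toℕ-injective; toℕ-fromℕ; toℕ-fromℕ<; toℕ-inject; toℕ≤pred[n]; +↔⊎)
open import Data.Vec as Vec using (Vec; []; _∷_; lookup; tabulate; toList; fromList)
open import Data.Vec.Properties using (lookup∘tabulate; toList-cast; toList∘fromList; length-toList)
open import Data.List as List
  using (List; []; _∷_; [_]; _++_; length; map; take; filter; concatMap; allFin; applyUpTo; upTo; cartesianProductWith)
open import Data.List.Properties
  using (length-take; length-map; length-++; map-++; length-upTo; length-tabulate; length-applyUpTo;
         filter-all; filter-reject; filter-accept)
open import Data.List.Membership.Propositional using (_∈_; lose; find)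
open import Data.List.Membership.Propositional.Properties
  using (∈-map⁻; ∈-lookup; ∈-filter⁻; ∈-allFin; ∈-++⁺ˡ; ∈-++⁺ʳ; ∈-++⁻; ∈-concatMap⁺; ∈-concatMap⁻;
         ∈-cartesianProductWith⁺; ∈-cartesianProductWith⁻)
import Data.List.Membership.DecPropositional as DecMembership
open import Data.List.Relation.Unary.Any using (Any; here; there; index)
import Data.List.Relation.Unary.Any.Properties as Any
open import Data.List.Relation.Unary.Any.Properties using (lookup-index)
open import Data.List.Relation.Unary.All using (All; []; _∷_)
import Data.List.Relation.Unary.All as All
import Data.List.Relation.Unary.All.Properties as All
open import Data.List.Relation.Unary.AllPairs using ([]; _∷_)
open import Data.List.Relation.Unary.Unique.Propositional using (Unique)
import Data.List.Relation.Unary.Unique.Propositional.Properties as Unique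
import Data.List.Relation.Unary.Unique.DecPropositional as DecUnique
open import Data.Sum using (inj₁; inj₂; [_,_]′)
open import Data.Product using (Σ; ∃; _×_; _,_; proj₁; proj₂)
open import Data.Unit using (tt)
open import Data.Empty using (⊥-elim)
open import Function using (_∘_; _↔_; Inverse)
open import Relation.Binary using (Decidable)
open import Relation.Binary.PropositionalEquality
  using (_≡_; _≢_; refl; sym; trans; cong; cong₂; subst; subst₂; module ≡-Reasoning)
open import Relation.Nullary using (¬_; Dec; yes; no)
open import Relation.Nullary.Decidable using (¬?; map′; decidable-stable; _×-dec_; _→-dec_)
import Relation.Unary as U

∈-take⁻ : ∀ {A : Set} n {xs : List A} {x} → x ∈ take n xs → x ∈ xs
∈-take⁻ (suc n) {_ ∷ _} (here p)  = here p
∈-take⁻ (suc n) {_ ∷ _} (there p) = there (∈-take⁻ n p)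

length-take-≤ : ∀ {A : Set} {n} (xs : List A) → n ≤ length xs → length (take n xs) ≡ n
length-take-≤ {n = n} xs n≤ = trans (length-take n xs) (m≤n⇒m⊓n≡m n≤)

length-concatMap : ∀ {A B : Set} {c} (f : A → List B) → (∀ x → length (f x) ≡ c) →
                   ∀ xs → length (concatMap f xs) ≡ length xs * c
length-concatMap f len []       = refl
length-concatMap f len (x ∷ xs) = trans (length-++ (f x)) (cong₂ _+_ (len x) (length-concatMap f len xs))

some-member : ∀ {A : Set} {k} (xs : List A) → length xs ≡ suc k → ∃ (_∈ xs)
some-member (x ∷ _) _ = x , here refl

module _ (x : ℕ) where

  ≢? : U.Decidable (_≢ x)
  ≢? y = ¬? (y ≟ x)

  without : List ℕ → List ℕ
  without = filter ≢?

  length-without : ∀ {xs} → Unique xs → length xs ≤ suc (length (without xs))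
  length-without {[]}     []          = z≤n
  length-without {y ∷ ys} (y∉ys ∷ ys!) with y ≟ x
  ... | yes refl = s≤s (≤-reflexive (sym (begin
    length (without (x ∷ ys)) ≡⟨ cong length (filter-reject ≢? (λ x≢x → x≢x refl)) ⟩
    length (without ys)       ≡⟨ cong length (filter-all ≢? (All.map (_∘ sym) y∉ys)) ⟩
    length ys                 ∎)))
    where open ≡-Reasoning
  ... | no y≢x   = subst (λ l → suc (length ys) ≤ suc l) (sym (cong length (filter-accept ≢? y≢x)))
                     (s≤s (length-without ys!))

applyUpTo-+ : ∀ {A : Set} (f : ℕ → A) m n → applyUpTo f (m + n) ≡ applyUpTo f m ++ applyUpTo (f ∘ (m +_)) n
applyUpTo-+ f zero    n = refl
applyUpTo-+ f (suc m) n = cong (f 0 ∷_) (applyUpTo-+ (f ∘ suc) m n)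

length-cartesianProductWith : ∀ {A B C : Set} (f : A → B → C) xs ys →
                              length (cartesianProductWith f xs ys) ≡ length xs * length ys
length-cartesianProductWith f []       ys = refl
length-cartesianProductWith f (x ∷ xs) ys =
  trans (length-++ (map (f x) ys)) (cong₂ _+_ (length-map (f x) ys) (length-cartesianProductWith f xs ys))

concatMap-unique : ∀ {A B : Set} (f : A → List B) (label : B → A) →
                   (∀ x → Unique (f x)) → (∀ x → All (λ y → label y ≡ x) (f x)) →
                   ∀ {xs} → Unique xs → Unique (concatMap f xs)
concatMap-unique f label unique labelled {[]}     []          = []
concatMap-unique f label unique labelled {x ∷ xs} (x∉xs ∷ xs!) =
  Unique.++⁺ (unique x) (concatMap-unique f label unique labelled xs!) disjoint
  where
  disjoint : ∀ {y} → ¬ (y ∈ f x × y ∈ concatMap f xs)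
  disjoint (y∈fx , y∈rest) with find (∈-concatMap⁻ f y∈rest)
  ... | x′ , x′∈xs , y∈fx′ = All.lookup x∉xs x′∈xs (trans (sym (All.lookup (labelled x) y∈fx)) (All.lookup (labelled x′) y∈fx′))

map-∈-∷-product : ∀ {A B : Set} (g : A → B) {xs xss y ys zs} → All (λ x → g x ≡ y) xs →
                  (∀ {zs′} → zs′ ∈ xss → map g zs′ ≡ ys) → zs ∈ cartesianProductWith List._∷_ xs xss → map g zs ≡ y ∷ ys
map-∈-∷-product g {xs} {xss} heads tails zs∈ with ∈-cartesianProductWith⁻ List._∷_ xs xss zs∈
... | x , zs′ , x∈ , zs′∈ , refl = cong₂ List._∷_ (All.lookup heads x∈) (tails zs′∈)

map-∈-++-product : ∀ {A B : Set} (g : A → B) {xss yss ys ys′ zs} → (∀ {xs} → xs ∈ xss → map g xs ≡ ys) →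
                   (∀ {xs′} → xs′ ∈ yss → map g xs′ ≡ ys′) → zs ∈ cartesianProductWith _++_ xss yss → map g zs ≡ ys ++ ys′
map-∈-++-product g {xss} {yss} left right zs∈ with ∈-cartesianProductWith⁻ _++_ xss yss zs∈
... | xs , xs′ , xs∈ , xs′∈ , refl = trans (map-++ g xs xs′) (cong₂ _++_ (left xs∈) (right xs′∈))

choices : ∀ {A : Set} → List (List A) → List (List A)
choices []         = [ [] ]
choices (xs ∷ xss) = cartesianProductWith List._∷_ xs (choices xss)

choices-All : ∀ {A : Set} {Q : A → Set} {xss} → All (Any Q) xss → ∃ λ zs → zs ∈ choices xss × All Q zs
choices-All []             = [] , here refl , []
choices-All (any ∷ anys) with find any | choices-All anys
... | y , y∈ , qy | zs , zs∈ , qzs = y ∷ zs , ∈-cartesianProductWith⁺ List._∷_ y∈ zs∈ , qy ∷ qzs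

^-distribʳ-* : ∀ a b n → (a * b) ^ n ≡ a ^ n * b ^ n
^-distribʳ-* a b zero    = refl
^-distribʳ-* a b (suc n) = trans (cong (a * b *_) (^-distribʳ-* a b n)) ([m*n]*[o*p]≡[m*o]*[n*p] a b (a ^ n) (b ^ n))

fifth-powers : ∀ t → (5 * t) ^ 5 ≡ 2101 * t ^ 5 + (4 * t) ^ 5
fifth-powers t = begin
  (5 * t) ^ 5                  ≡⟨ ^-distribʳ-* 5 t 5 ⟩
  (2101 + 1024) * t ^ 5        ≡⟨ *-distribʳ-+ (t ^ 5) 2101 1024 ⟩
  2101 * t ^ 5 + 4 ^ 5 * t ^ 5 ≡⟨ cong (2101 * t ^ 5 +_) (sym (^-distribʳ-* 4 t 5)) ⟩
  2101 * t ^ 5 + (4 * t) ^ 5   ∎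
  where open ≡-Reasoning

-- 2101² / 5¹⁰ = 0.45202... ≤ 0.4643
2101²-bound : ∀ t z → 10000 * (2101 * t ^ 5 * (2101 * t ^ 5 * z)) ≤ 4643 * ((5 * t) ^ 10 * z)
2101²-bound t z = begin
  10000 * (2101 * t ^ 5 * (2101 * t ^ 5 * z)) ≡⟨ regroup 10000 2101 (t ^ 5) z ⟩
  10000 * 2101 * 2101 * (t ^ 5 * t ^ 5 * z)   ≤⟨ *-monoˡ-≤ (t ^ 5 * t ^ 5 * z) (≤ᵇ⇒≤ (10000 * 2101 * 2101) (4643 * 5 ^ 10) tt) ⟩
  4643 * 5 ^ 10 * (t ^ 5 * t ^ 5 * z)         ≡⟨ regroup′ 4643 (5 ^ 10) (t ^ 5 * t ^ 5) z ⟩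
  4643 * (5 ^ 10 * (t ^ 5 * t ^ 5) * z)       ≡⟨ cong (λ x → 4643 * (x * z)) tenth-power ⟩
  4643 * ((5 * t) ^ 10 * z)                   ∎
  where
  open ≤-Reasoning
  regroup : ∀ c d y z → c * (d * y * (d * y * z)) ≡ c * d * d * (y * y * z)
  regroup = solve-∀
  regroup′ : ∀ a b x z → a * b * (x * z) ≡ a * (b * x * z)
  regroup′ = solve-∀
  tenth-power : 5 ^ 10 * (t ^ 5 * t ^ 5) ≡ (5 * t) ^ 10
  tenth-power = trans (cong (5 ^ 10 *_) (sym (^-distribˡ-+-* t 5 5))) (sym (^-distribʳ-* 5 t 10))

least-counterexample : ∀ {P : ℕ → Set} → U.Decidable P → ∀ {n₀} → ¬ P n₀ →
                       ∃ λ n → n ≤ n₀ × ¬ P n × (∀ n′ → n′ < n → P n′)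
least-counterexample {P} P? {n₀} ¬Pn₀
  with ¬∀⟶∃¬-smallest (suc n₀) (P ∘ toℕ) (P? ∘ toℕ) (λ all → ¬Pn₀ (subst P (toℕ-fromℕ n₀) (all (Fin.fromℕ n₀))))
... | i , ¬Pi , below = toℕ i , toℕ≤pred[n] i , ¬Pi , λ n′ n′<i →
  subst P (trans (toℕ-inject (Fin.fromℕ< n′<i)) (toℕ-fromℕ< n′<i)) (below (Fin.fromℕ< n′<i))

truncate : ∀ {V : Set} k (M : V → List ℕ) → (∀ v → Unique (M v)) → (∀ v → k ≤ length (M v)) →
           ListAssignment V k
truncate k M unique long = record
  { L        = λ v → take k (M v)
  ; distinct = λ v → Unique.take⁺ k (unique v)
  ; size     = λ v → length-take-≤ (M v) (long v)
  }

Choosable-mono : ∀ {V Adj j k} → j ≤ k → Choosable V Adj j → Choosable V Adj k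
Choosable-mono {j = j} j≤k ch A with ch (truncate j (L A) (distinct A) (λ v → subst (j ≤_) (sym (size A v)) j≤k))
... | c , mem , proper = c , (λ v → ∈-take⁻ j (mem v)) , proper

Choosable-edgeless : ∀ {V Adj k} → (∀ u v → ¬ Adj u v) → Choosable V Adj (suc k)
Choosable-edgeless noEdge A =
  (λ v → proj₁ (some-member (L A v) (size A v))) ,
  (λ v → proj₂ (some-member (L A v) (size A v))) ,
  (λ u v adj → ⊥-elim (noEdge u v adj))

Choosable-retract : ∀ {V W : Set} {AdjV : V → V → Set} {AdjW : W → W → Set} {k}
                    (f : W → V) (g : V → W) → (∀ x → f (g x) ≡ x) →
                    (∀ {x y} → AdjV x y → AdjW (g x) (g y)) →
                    Choosable W AdjW k → Choosable V AdjV k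
Choosable-retract f g fg≡ hom ch A with ch record { L = L A ∘ f ; distinct = distinct A ∘ f ; size = size A ∘ f }
... | c , mem , proper =
  c ∘ g , (λ x → subst (λ y → c (g x) ∈ L A y) (fg≡ x) (mem (g x))) , (λ x y adj → proper (g x) (g y) (hom adj))

Exhaustible : Set → Set₁
Exhaustible X = ∀ {P : X → Set} → U.Decidable P → Dec (∃ P)

∀? : ∀ {X} → Exhaustible X → ∀ {P : X → Set} → U.Decidable P → Dec (∀ x → P x)
∀? search P? = map′ (λ noCounterexample x → decidable-stable (P? x) (λ ¬px → noCounterexample (x , ¬px)))
                    (λ all (x , ¬px) → ¬px (all x))
                    (¬? (search (¬? ∘ P?)))

Vec-exhaustible : ∀ {X n} → Exhaustible X → Exhaustible (Vec X n)
Vec-exhaustible {n = zero}  search P? = map′ ([] ,_) (λ { ([] , p) → p }) (P? [])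
Vec-exhaustible {n = suc n} search P? =
  map′ (λ (x , xs , p) → x ∷ xs , p) (λ { (x ∷ xs , p) → x , xs , p })
       (search (λ x → Vec-exhaustible search (λ xs → P? (x ∷ xs))))

-- indexOf sends non-members of U to the index length U, which `at` decodes to
-- the junk value 0.
indexOf : ℕ → (U : List ℕ) → Fin (suc (length U))
indexOf x []       = zero
indexOf x (y ∷ ys) with x ≟ y
... | yes _ = zero
... | no _  = suc (indexOf x ys)

at : (U : List ℕ) → Fin (suc (length U)) → ℕ
at []       _       = 0
at (y ∷ ys) zero    = y
at (y ∷ ys) (suc i) = at ys i

at-indexOf : ∀ {x} U → x ∈ U → at U (indexOf x U) ≡ x
at-indexOf {x} (y ∷ ys) x∈ with x ≟ y
at-indexOf (y ∷ ys) x∈         | yes x≡y = sym x≡y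
at-indexOf (y ∷ ys) (here x≡y) | no x≢y  = ⊥-elim (x≢y x≡y)
at-indexOf (y ∷ ys) (there x∈) | no _    = at-indexOf ys x∈

map-at-indexOf : ∀ U {xs} → (∀ {x} → x ∈ xs → x ∈ U) → map (at U) (map (λ x → indexOf x U) xs) ≡ xs
map-at-indexOf U {[]}     xs⊆U = refl
map-at-indexOf U {x ∷ xs} xs⊆U = cong₂ _∷_ (at-indexOf U (xs⊆U (here refl))) (map-at-indexOf U (xs⊆U ∘ there))

module FiniteGraph {v} (Adj : Fin v → Fin v → Set) (Adj? : Decidable Adj) (k : ℕ) where

  FinListAssignment : ℕ → Set
  FinListAssignment N = Vec (Vec (Fin N) k) v

  ProperFinColoring : ∀ {N} → FinListAssignment N → Vec (Fin N) v → Set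
  ProperFinColoring Ls cs = (∀ i → lookup cs i ∈ toList (lookup Ls i)) × (∀ i j → Adj i j → lookup cs i ≢ lookup cs j)

  FinChoosable : ℕ → Set
  FinChoosable N = (Ls : FinListAssignment N) → (∀ i → Unique (toList (lookup Ls i))) → ∃ (ProperFinColoring Ls)

  finChoosable? : ∀ N → Dec (FinChoosable N)
  finChoosable? N =
    ∀? (Vec-exhaustible (Vec-exhaustible any?)) λ Ls →
      ∀? any? (λ i → DecUnique.unique? Fin._≟_ (toList (lookup Ls i))) →-dec
      Vec-exhaustible any? λ cs →
        ∀? any? (λ i → DecMembership._∈?_ Fin._≟_ (lookup cs i) (toList (lookup Ls i))) ×-dec
        ∀? any? (λ i → ∀? any? (λ j → Adj? i j →-dec ¬? (lookup cs i Fin.≟ lookup cs j)))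

  Choosable⇒FinChoosable : Choosable (Fin v) Adj k → ∀ N → FinChoosable N
  Choosable⇒FinChoosable ch N Ls unique with ch record
    { L        = λ i → map toℕ (toList (lookup Ls i))
    ; distinct = λ i → Unique.map⁺ toℕ-injective (unique i)
    ; size     = λ i → trans (length-map toℕ (toList (lookup Ls i))) (length-toList (lookup Ls i))
    }
  ... | c , mem , proper = tabulate color , mem′ , proper′
    where
    preimage : ∀ i → ∃ λ a → a ∈ toList (lookup Ls i) × c i ≡ toℕ a
    preimage i = ∈-map⁻ toℕ (mem i)
    color : Fin v → Fin N
    color = proj₁ ∘ preimage
    mem′ : ∀ i → lookup (tabulate color) i ∈ toList (lookup Ls i)
    mem′ i rewrite lookup∘tabulate color i = proj₁ (proj₂ (preimage i))
    proper′ : ∀ i j → Adj i j → lookup (tabulate color) i ≢ lookup (tabulate color) j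
    proper′ i j adj same = proper i j adj (begin
      c i              ≡⟨ proj₂ (proj₂ (preimage i)) ⟩
      toℕ (color i)    ≡⟨ cong toℕ (trans (sym (lookup∘tabulate color i)) (trans same (lookup∘tabulate color j))) ⟩
      toℕ (color j)    ≡⟨ sym (proj₂ (proj₂ (preimage j))) ⟩
      c j              ∎)
      where open ≡-Reasoning

  -- Colors are renamed by their position in the concatenation U of all lists,
  -- which is injective on the colors that occur.
  module Relabelling (A : ListAssignment (Fin v) k) where

    U : List ℕ
    U = concatMap (L A) (allFin v)

    length-U : length U ≡ v * k
    length-U = trans (length-concatMap (L A) (size A) (allFin v)) (cong (_* k) (length-tabulate {n = v} (λ i → i)))

    L⊆U : ∀ i {x} → x ∈ L A i → x ∈ U
    L⊆U i x∈ = ∈-concatMap⁺ (L A) (lose (∈-allFin i) x∈)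

    ρ : ℕ → Fin (suc (length U))
    ρ x = indexOf x U

    row : Fin v → Vec (Fin (suc (length U))) k
    row i = Vec.cast (trans (length-map ρ (L A i)) (size A i)) (fromList (map ρ (L A i)))

    Ls : FinListAssignment (suc (length U))
    Ls = tabulate row

    toList-Ls : ∀ i → toList (lookup Ls i) ≡ map ρ (L A i)
    toList-Ls i = trans (cong toList (lookup∘tabulate row i)) (trans (toList-cast _ (fromList _)) (toList∘fromList _))

    unique : ∀ i → Unique (toList (lookup Ls i))
    unique i = subst Unique (sym (toList-Ls i)) (Unique.map⁻ (subst Unique (sym (map-at-indexOf U (L⊆U i))) (distinct A i)))

    decode : ∃ (ProperFinColoring Ls) → Σ (Fin v → ℕ) (ProperLColoring (Fin v) Adj A)
    decode (cs , mem , proper) = at U ∘ lookup cs , (λ i → proj₁ (decoded i)) , proper′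
      where
      decoded : ∀ i → at U (lookup cs i) ∈ L A i × ρ (at U (lookup cs i)) ≡ lookup cs i
      decoded i with ∈-map⁻ ρ (subst (lookup cs i ∈_) (toList-Ls i) (mem i))
      ... | x , x∈ , cs≡ρx = subst (_∈ L A i) (sym at≡x) x∈ , trans (cong ρ at≡x) (sym cs≡ρx)
        where at≡x = trans (cong (at U) cs≡ρx) (at-indexOf U (L⊆U i x∈))
      proper′ : ∀ i j → Adj i j → at U (lookup cs i) ≢ at U (lookup cs j)
      proper′ i j adj same = proper i j adj (trans (sym (proj₂ (decoded i))) (trans (cong ρ same) (proj₂ (decoded j))))

  FinChoosable⇒Choosable : FinChoosable (suc (v * k)) → Choosable (Fin v) Adj k
  FinChoosable⇒Choosable fin A = decode (subst (FinChoosable ∘ suc) (sym length-U) fin Ls unique)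
    where open Relabelling A

  choosable? : Dec (Choosable (Fin v) Adj k)
  choosable? = map′ FinChoosable⇒Choosable (λ ch → Choosable⇒FinChoosable ch _) (finChoosable? (suc (v * k)))

choosable? : ∀ {v} {V : Set} {Adj : V → V → Set} → Fin v ↔ V → Decidable Adj → ∀ k → Dec (Choosable V Adj k)
choosable? {Adj = Adj} ι Adj? k =
  map′ (Choosable-retract to from strictlyInverseˡ (subst₂ Adj (sym (strictlyInverseˡ _)) (sym (strictlyInverseˡ _))))
       (Choosable-retract from to strictlyInverseʳ (λ adj → adj))
       (FiniteGraph.choosable? (λ i j → Adj (to i) (to j)) (λ i j → Adj? (to i) (to j)) k)
  where open Inverse ι

KChoosable : ℕ → ℕ → ℕ → Set
KChoosable m n = Choosable (KV m n) (KAdj m n)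

K-edgeless : ∀ m u v → ¬ KAdj m 0 u v
K-edgeless m (inj₁ _) (inj₁ _) ()
K-edgeless m (inj₁ _) (inj₂ ())
K-edgeless m (inj₂ ())

K-choosable-suc : ∀ {m n k} → KChoosable m n k → KChoosable m (suc n) (suc k)
K-choosable-suc {m} {n} {k} ch A with some-member (L A (inj₂ zero)) (size A (inj₂ zero))
... | x , x∈ with ch (truncate k M unique long)
  where
  M : KV m n → List ℕ
  M (inj₁ a) = without x (L A (inj₁ a))
  M (inj₂ b) = L A (inj₂ (suc b))
  unique : ∀ v → Unique (M v)
  unique (inj₁ a) = Unique.filter⁺ _ (distinct A (inj₁ a))
  unique (inj₂ b) = distinct A (inj₂ (suc b))
  long : ∀ v → k ≤ length (M v)
  long (inj₁ a) = s≤s⁻¹ (subst (_≤ suc (length (M (inj₁ a)))) (size A (inj₁ a)) (length-without x (distinct A (inj₁ a))))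
  long (inj₂ b) = subst (k ≤_) (sym (size A (inj₂ (suc b)))) (n≤1+n k)
... | c , mem , proper = c′ , mem′ , proper′
  where
  c′ : KV m (suc n) → ℕ
  c′ (inj₁ a)       = c (inj₁ a)
  c′ (inj₂ zero)    = x
  c′ (inj₂ (suc b)) = c (inj₂ b)
  left : ∀ a → c (inj₁ a) ∈ L A (inj₁ a) × c (inj₁ a) ≢ x
  left a = ∈-filter⁻ _ (∈-take⁻ k (mem (inj₁ a)))
  mem′ : ∀ v → c′ v ∈ L A v
  mem′ (inj₁ a)       = proj₁ (left a)
  mem′ (inj₂ zero)    = x∈
  mem′ (inj₂ (suc b)) = ∈-take⁻ k (mem (inj₂ b))
  proper′ : ∀ u v → KAdj m (suc n) u v → c′ u ≢ c′ v
  proper′ (inj₁ a) (inj₂ zero)    _ = proj₂ (left a)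
  proper′ (inj₂ zero) (inj₁ a)    _ = proj₂ (left a) ∘ sym
  proper′ (inj₁ a) (inj₂ (suc b)) _ = proper (inj₁ a) (inj₂ b) tt
  proper′ (inj₂ (suc b)) (inj₁ a) _ = proper (inj₂ b) (inj₁ a) tt

KAdj? : ∀ m n → Decidable (KAdj m n)
KAdj? m n (inj₁ _) (inj₁ _) = no λ ()
KAdj? m n (inj₁ _) (inj₂ _) = yes tt
KAdj? m n (inj₂ _) (inj₁ _) = yes tt
KAdj? m n (inj₂ _) (inj₂ _) = no λ ()

K-choosable? : ∀ m n k → Dec (KChoosable m n k)
K-choosable? m n = choosable? +↔⊎ (KAdj? m n)

least-nonchoosable⇒IsNm : ∀ {k n} → 1 ≤ k → ¬ KChoosable (2 + k) n k →
                          (∀ n′ → n′ < n → KChoosable (2 + k) n′ k) → IsNm (2 + k) n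
least-nonchoosable⇒IsNm {suc k} {zero}  _ ¬ch below = ⊥-elim (¬ch (Choosable-edgeless (K-edgeless (2 + suc k))))
least-nonchoosable⇒IsNm {suc k} {suc n} _ ¬ch below =
  s≤s z≤n ,
  (K-choosable-suc (below n ≤-refl) , λ j j<k+2 ch → ¬ch (Choosable-mono (s≤s⁻¹ j<k+2) ch)) ,
  λ n′ _ n′<n (_ , notBelow) → notBelow (suc k) ≤-refl (below n′ n′<n)

module Construction (s : ℕ) where

  -- t is opaque: unfolding t = 2 + s makes Agda's conversion checker expand
  -- polynomials in t (such as 2101 * t ^ 5) into towers of suc.
  opaque
    t : ℕ
    t = 2 + s

    t≡2+s : t ≡ 2 + s
    t≡2+s = refl

  k : ℕ
  k = 5 * t

  k≡10+5s : k ≡ 10 + 5 * s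
  k≡10+5s = trans (cong (5 *_) t≡2+s) (*-distribˡ-+ 5 2 s)

  1≤k : 1 ≤ k
  1≤k = subst (1 ≤_) (sym k≡10+5s) (s≤s z≤n)

  s≤2+k : s ≤ 2 + k
  s≤2+k = subst (λ x → s ≤ 2 + x) (sym k≡10+5s) (≤-trans (m≤m+n s (4 * s)) (m≤n+m (5 * s) 12))

  instance
    k-nonZero : NonZero k
    k-nonZero = subst NonZero (sym k≡10+5s) _

  color : ℕ → ℕ → ℕ
  color w i = i + w * k

  block : ℕ → ℕ
  block y = y / k

  block-color : ∀ w {i} → i < k → block (color w i) ≡ w
  block-color w {i} i<k = trans (+-distrib-/-∣ʳ i (n∣m*n w)) (cong₂ _+_ (m<n⇒m/n≡0 i<k) (m*n/n≡m w k))

  color-injective : ∀ w {i j} → color w i ≡ color w j → i ≡ j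
  color-injective w = +-cancelʳ-≡ (w * k) _ _

  B P Q : ℕ → List ℕ
  B w = applyUpTo (color w) k
  P w = applyUpTo (color w) t
  Q w = applyUpTo (color w ∘ (t +_)) (4 * t)

  B≡P++Q : ∀ w → B w ≡ P w ++ Q w
  B≡P++Q w = applyUpTo-+ (color w) t (4 * t)

  B-block : ∀ w → All (λ y → block y ≡ w) (B w)
  B-block w = All.applyUpTo⁺₁ (color w) k (block-color w)

  P-block : ∀ w → All (λ y → block y ≡ w) (P w)
  P-block w = All.++⁻ˡ (P w) (subst (All (λ y → block y ≡ w)) (B≡P++Q w) (B-block w))

  Q-block : ∀ w → All (λ y → block y ≡ w) (Q w)
  Q-block w = All.++⁻ʳ (P w) (subst (All (λ y → block y ≡ w)) (B≡P++Q w) (B-block w))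

  applyUpTo-color-unique : ∀ w n → Unique (applyUpTo (color w) n)
  applyUpTo-color-unique w n = Unique.applyUpTo⁺₁ (color w) n (λ i<j _ → <⇒≢ i<j ∘ color-injective w)

  hub : List ℕ → List ℕ
  hub = concatMap P

  hub-unique : ∀ {ws} → Unique ws → Unique (hub ws)
  hub-unique = concatMap-unique P block (λ w → applyUpTo-color-unique w t) P-block

  length-hub : ∀ ws → length (hub ws) ≡ length ws * t
  length-hub = length-concatMap P (λ w → length-applyUpTo (color w) t)

  -- The transversals of the blocks ws that meet some P w, split by the first
  -- block where they do: all transversals except those lying inside the Q w.
  P-transversals : List ℕ → List (List ℕ)
  P-transversals []       = []
  P-transversals (w ∷ ws) = cartesianProductWith List._∷_ (P w) (choices (map B ws))
                         ++ cartesianProductWith List._∷_ (Q w) (P-transversals ws)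

  choices-block : ∀ ws {zs} → zs ∈ choices (map B ws) → map block zs ≡ ws
  choices-block []       (here refl) = refl
  choices-block (w ∷ ws) = map-∈-∷-product block (B-block w) (choices-block ws)

  P-transversals-block : ∀ ws {zs} → zs ∈ P-transversals ws → map block zs ≡ ws
  P-transversals-block (w ∷ ws) zs∈ =
    [ map-∈-∷-product block (P-block w) (choices-block ws) , map-∈-∷-product block (Q-block w) (P-transversals-block ws) ]′
    (∈-++⁻ (cartesianProductWith List._∷_ (P w) (choices (map B ws))) zs∈)

  length-choices-B : ∀ ws → length (choices (map B ws)) ≡ k ^ length ws
  length-choices-B []       = refl
  length-choices-B (w ∷ ws) =
    trans (length-cartesianProductWith List._∷_ (B w) (choices (map B ws))) (cong₂ _*_ (length-applyUpTo (color w) k) (length-choices-B ws))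

  length-P-transversals : ∀ ws → length (P-transversals ws) + (4 * t) ^ length ws ≡ k ^ length ws
  length-P-transversals []       = refl
  length-P-transversals (w ∷ ws) = begin
    length (P-transversals (w ∷ ws)) + 4 * t * (4 * t) ^ r ≡⟨ cong (_+ 4 * t * (4 * t) ^ r) split ⟩
    t * k ^ r + 4 * t * X + 4 * t * (4 * t) ^ r           ≡⟨ +-assoc (t * k ^ r) _ _ ⟩
    t * k ^ r + (4 * t * X + 4 * t * (4 * t) ^ r)         ≡⟨ cong (t * k ^ r +_) (sym (*-distribˡ-+ (4 * t) X _)) ⟩
    t * k ^ r + 4 * t * (X + (4 * t) ^ r)                 ≡⟨ cong (λ x → t * k ^ r + 4 * t * x) (length-P-transversals ws) ⟩
    t * k ^ r + 4 * t * k ^ r                             ≡⟨ sym (*-distribʳ-+ (k ^ r) t (4 * t)) ⟩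
    k * k ^ r                                             ∎
    where
    open ≡-Reasoning
    r = length ws
    X = length (P-transversals ws)
    split : length (P-transversals (w ∷ ws)) ≡ t * k ^ r + 4 * t * X
    split = trans (length-++ (cartesianProductWith List._∷_ (P w) (choices (map B ws))))
      (cong₂ _+_ (trans (length-cartesianProductWith List._∷_ (P w) (choices (map B ws))) (cong₂ _*_ (length-applyUpTo (color w) t) (length-choices-B ws)))
                 (trans (length-cartesianProductWith List._∷_ (Q w) (P-transversals ws)) (cong (_* X) (length-applyUpTo (color w ∘ (t +_)) (4 * t)))))

  module _ {Img : ℕ → Set} where

    P-transversals-start : ∀ w ws → All (Any Img ∘ B) ws → Any Img (P w) →
                           ∃ λ zs → zs ∈ P-transversals (w ∷ ws) × All Img zs
    P-transversals-start w ws inBlocks inP with find inP | choices-All (All.map⁺ inBlocks)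
    ... | y , y∈ , iy | zs , zs∈ , izs = y ∷ zs , ∈-++⁺ˡ (∈-cartesianProductWith⁺ List._∷_ y∈ zs∈) , iy ∷ izs

    -- Walk through the blocks: if the chosen color of block w lies in Q w, the
    -- transversal may start with it provided the hub color lies further on.
    P-transversals-cover : ∀ ws → All (Any Img ∘ B) ws → Any Img (hub ws) →
                           ∃ λ zs → zs ∈ P-transversals ws × All Img zs
    P-transversals-cover (w ∷ ws) (inB ∷ inBlocks) inHub with Any.++⁻ (P w) (subst (Any Img) (B≡P++Q w) inB)
    ... | inj₁ inP = P-transversals-start w ws inBlocks inP
    ... | inj₂ inQ with Any.++⁻ (P w) inHub
    ...   | inj₁ hubInP = P-transversals-start w ws inBlocks hubInP
    ...   | inj₂ inRest with find inQ | P-transversals-cover ws inBlocks inRest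
    ...     | y , y∈ , iy | zs , zs∈ , izs =
      y ∷ zs , ∈-++⁺ʳ (cartesianProductWith List._∷_ (P w) (choices (map B ws))) (∈-cartesianProductWith⁺ List._∷_ y∈ zs∈) , iy ∷ izs

  g₁ g₂ rest : List ℕ
  g₁   = upTo 5
  g₂   = applyUpTo (5 +_) 5
  rest = applyUpTo (10 +_) (5 * s)

  blocks : List ℕ
  blocks = g₁ ++ g₂ ++ rest

  blocks-unique : Unique blocks
  blocks-unique = Unique.upTo⁺ (10 + 5 * s)

  blocks-length : length blocks ≡ k
  blocks-length = trans (length-upTo (10 + 5 * s)) (sym k≡10+5s)

  _⊗_ : List (List ℕ) → List (List ℕ) → List (List ℕ)
  _⊗_ = cartesianProductWith _++_

  family : List ℕ → List ℕ → List ℕ → List (List ℕ)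
  family ws₁ ws₂ ws₃ = P-transversals ws₁ ⊗ (P-transversals ws₂ ⊗ choices (map B ws₃))

  family-block : ∀ ws₁ ws₂ ws₃ {zs} → zs ∈ family ws₁ ws₂ ws₃ → map block zs ≡ ws₁ ++ ws₂ ++ ws₃
  family-block ws₁ ws₂ ws₃ =
    map-∈-++-product block (P-transversals-block ws₁) (map-∈-++-product block (P-transversals-block ws₂) (choices-block ws₃))

  family-cover : ∀ {Img : ℕ → Set} ws₁ ws₂ ws₃ → All (Any Img ∘ B) (ws₁ ++ ws₂ ++ ws₃) →
                 Any Img (hub ws₁) → Any Img (hub ws₂) → ∃ λ zs → zs ∈ family ws₁ ws₂ ws₃ × All Img zs
  family-cover ws₁ ws₂ ws₃ inBlocks inHub₁ inHub₂
    with z₁ , z₁∈ , used₁ ← P-transversals-cover ws₁ (All.++⁻ˡ ws₁ inBlocks) inHub₁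
    with z₂ , z₂∈ , used₂ ← P-transversals-cover ws₂ (All.++⁻ˡ ws₂ (All.++⁻ʳ ws₁ inBlocks)) inHub₂
    with z₃ , z₃∈ , used₃ ← choices-All (All.map⁺ (All.++⁻ʳ ws₂ (All.++⁻ʳ ws₁ inBlocks)))
    = z₁ ++ z₂ ++ z₃ ,
      ∈-cartesianProductWith⁺ _++_ z₁∈ (∈-cartesianProductWith⁺ _++_ z₂∈ z₃∈) ,
      All.++⁺ used₁ (All.++⁺ used₂ used₃)

  family-unique : ∀ {zs} → zs ∈ family g₁ g₂ rest → Unique zs
  family-unique zs∈ = Unique.map⁻ (subst Unique (sym (family-block g₁ g₂ rest zs∈)) blocks-unique)

  family-length : ∀ {zs} → zs ∈ family g₁ g₂ rest → length zs ≡ k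
  family-length {zs} zs∈ = trans (sym (length-map block zs)) (trans (cong length (family-block g₁ g₂ rest zs∈)) blocks-length)

  n₀ : ℕ
  n₀ = length (family g₁ g₂ rest)

  left : Fin (2 + k) → List ℕ
  left zero          = hub g₁
  left (suc zero)    = hub g₂
  left (suc (suc j)) = B (toℕ j)

  left-unique : ∀ a → Unique (left a)
  left-unique zero          = hub-unique {g₁} (Unique.upTo⁺ 5)
  left-unique (suc zero)    = hub-unique {g₂} (Unique.drop⁺ 5 (Unique.upTo⁺ 10))
  left-unique (suc (suc j)) = applyUpTo-color-unique (toℕ j) k

  left-length : ∀ a → length (left a) ≡ k
  left-length zero          = length-hub g₁
  left-length (suc zero)    = length-hub g₂
  left-length (suc (suc j)) = length-applyUpTo (color (toℕ j)) k

  assignment : ListAssignment (KV (2 + k) n₀) k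
  assignment = record
    { L        = λ { (inj₁ a) → left a ; (inj₂ b) → List.lookup (family g₁ g₂ rest) b }
    ; distinct = λ { (inj₁ a) → left-unique a ; (inj₂ b) → family-unique (∈-lookup b) }
    ; size     = λ { (inj₁ a) → left-length a ; (inj₂ b) → family-length (∈-lookup b) }
    }

  Used : (KV (2 + k) n₀ → ℕ) → ℕ → Set
  Used c y = ∃ λ a → c (inj₁ a) ≡ y

  module _ {c : KV (2 + k) n₀ → ℕ} (mem : ∀ v → c v ∈ L assignment v) where

    blocks-used : All (Any (Used c) ∘ B) blocks
    blocks-used = All.applyUpTo⁺₁ (λ w → w) (10 + 5 * s) λ {w} w<10+5s →
      let w<k = subst (w <_) (sym k≡10+5s) w<10+5s
          a   = suc (suc (Fin.fromℕ< w<k))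
      in lose (subst (λ i → c (inj₁ a) ∈ B i) (toℕ-fromℕ< w<k) (mem (inj₁ a))) (a , refl)

    exhausted-list : ∃ λ zs → zs ∈ family g₁ g₂ rest × All (Used c) zs
    exhausted-list = family-cover g₁ g₂ rest blocks-used (lose (mem (inj₁ zero)) (zero , refl)) (lose (mem (inj₁ (suc zero))) (suc zero , refl))

  not-choosable : ¬ KChoosable (2 + k) n₀ k
  not-choosable ch =
    let c , mem , proper = ch assignment
        zs , zs∈ , used  = exhausted-list mem
        b                = index zs∈
        a , same         = All.lookup used (subst (c (inj₂ b) ∈_) (sym (lookup-index zs∈)) (mem (inj₂ b)))
    in proper (inj₁ a) (inj₂ b) tt same

  length-family : n₀ ≡ length (P-transversals g₁) * (length (P-transversals g₂) * k ^ (5 * s))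
  length-family =
    trans (length-cartesianProductWith _++_ (P-transversals g₁) (P-transversals g₂ ⊗ choices (map B rest)))
      (cong (length (P-transversals g₁) *_)
        (trans (length-cartesianProductWith _++_ (P-transversals g₂) (choices (map B rest)))
          (cong (length (P-transversals g₂) *_)
            (trans (length-choices-B rest) (cong (k ^_) (length-applyUpTo (10 +_) (5 * s)))))))

  length-P-transversals-5 : ∀ ws → length ws ≡ 5 → length (P-transversals ws) ≡ 2101 * t ^ 5
  length-P-transversals-5 ws |ws|≡5 = +-cancelʳ-≡ ((4 * t) ^ 5) (length (P-transversals ws)) (2101 * t ^ 5)
    (trans (subst (λ r → length (P-transversals ws) + (4 * t) ^ r ≡ k ^ r) |ws|≡5 (length-P-transversals ws)) (fifth-powers t))

  n₀≡ : n₀ ≡ 2101 * t ^ 5 * (2101 * t ^ 5 * k ^ (5 * s))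
  n₀≡ = trans length-family
    (cong₂ (λ x y → x * (y * k ^ (5 * s))) (length-P-transversals-5 g₁ refl) (length-P-transversals-5 g₂ refl))

  family-bound : 10000 * n₀ ≤ 4643 * k ^ k
  family-bound = begin
    10000 * n₀                                            ≡⟨ cong (10000 *_) n₀≡ ⟩
    10000 * (2101 * t ^ 5 * (2101 * t ^ 5 * k ^ (5 * s))) ≤⟨ 2101²-bound t (k ^ (5 * s)) ⟩
    4643 * (k ^ 10 * k ^ (5 * s))                         ≡⟨ cong (4643 *_) (sym (^-distribˡ-+-* k 10 (5 * s))) ⟩
    4643 * k ^ (10 + 5 * s)                               ≡⟨ cong (λ e → 4643 * k ^ e) (sym k≡10+5s) ⟩
    4643 * k ^ k                                          ∎
    where open ≤-Reasoning

theorem2 : (N : ℕ) → Σ ℕ (λ m → (N ≤ m) × (3 ≤ m) × Σ ℕ (λ n → IsNm m n × (10000 * n ≤ 4643 * ((m ∸ 2) ^ (m ∸ 2)))))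
theorem2 N = witness (least-counterexample (λ n → K-choosable? (2 + k) n k) not-choosable)
  where
  open Construction N
  witness : (∃ λ n → n ≤ n₀ × ¬ KChoosable (2 + k) n k × (∀ n′ → n′ < n → KChoosable (2 + k) n′ k)) →
            Σ ℕ (λ m → (N ≤ m) × (3 ≤ m) × Σ ℕ (λ n → IsNm m n × (10000 * n ≤ 4643 * ((m ∸ 2) ^ (m ∸ 2)))))
  witness (n , n≤n₀ , ¬ch , below) =
    2 + k , s≤2+k , s≤s (s≤s 1≤k) ,
    n , least-nonchoosable⇒IsNm 1≤k ¬ch below , ≤-trans (*-monoʳ-≤ 10000 n≤n₀) family-bound
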